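{- Let $n\geq 2$ be an integer and let $M$ be an $n$-connected binary matroid with $|E(M)|\geq 2n-2$. Suppose $T\subset E(M)$ with $|T|=n-1$. If $|Q|\geq 2|Q\cap T|$ for every cocircuit $Q$ of $M$ with $Q\cap T\neq\emptyset$, then $M'_T$ is $n$-connected.
   Context: Element splitting: let $M$ be a binary matroid with standard matrix representation $A$ over $GF(2)$ and $T\subseteq E(M)$. Let $A'_T$ be the matrix obtained from $A$ by adjoining an extra row whose entries are $1$ in the columns labelled by elements of $T$ and $0$ otherwise, and then adjoining an extra column labelled by a new element $a$ with $1$ in the last row and $0$ elsewhere. $M'_T$ denotes the vector matroid of $A'_T$. A matroid is $n$-connected if it has no $k$-separation for any $k<n$, where a $k$-separation of a matroid $N$ with rank function $r$ is a partition $(X,Y)$ of $E(N)$ with $\min\{|X|,|Y|\}\geq k$ and $r(X)+r(Y)-r(E(N))\leq k-1$. -}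

module Defs where

open import Data.Nat using (ℕ; zero; suc; _+_; _<_; _≤_)
open import Data.Bool using (Bool; true; false; _∧_; _xor_)
open import Data.Fin using (Fin; zero; suc; splitAt; _≟_)
open import Data.Fin.Subset using (Subset; _⊆_; ∁; ⊤; ∣_∣; Nonempty)
open import Data.Vec using (lookup)
open import Data.Sum using ([_,_])
open import Data.Product using (Σ; ∃; ∃-syntax; _×_)
open import Relation.Nullary using (¬_)
open import Relation.Nullary.Decidable using (⌊_⌋)
open import Relation.Binary.PropositionalEquality using (_≡_)

-- A matrix over GF(2) = Bool (with xor as addition, ∧ as multiplication),
-- with r rows and m columns; the columns are the ground set E = Fin m.
Matrix : ℕ → ℕ → Set
Matrix r m = Fin r → Fin m → Bool

sumSel : ∀ {m} → (Fin m → Bool) → (Fin m → Bool) → Bool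
sumSel {zero}  s v = false
sumSel {suc m} s v = (s zero ∧ v zero) xor sumSel (λ j → s (suc j)) (λ j → v (suc j))

colSum : ∀ {r m} → Matrix r m → Subset m → Fin r → Bool
colSum A S i = sumSel (lookup S) (A i)

Independent : ∀ {r m} → Matrix r m → Subset m → Set
Independent A I = ∀ S → S ⊆ I → Nonempty S → ¬ (∀ i → colSum A S i ≡ false)

IsRank : ∀ {r m} → Matrix r m → Subset m → ℕ → Set
IsRank A X k =
  (∃[ I ] (I ⊆ X × Independent A I × ∣ I ∣ ≡ k)) ×
  (∀ I → I ⊆ X → Independent A I → ∣ I ∣ ≤ k)

-- (X , E - X) is a k-separation of M[A]:
-- min(|X|,|Y|) ≥ k and r(X) + r(Y) - r(E) ≤ k - 1  (i.e. r(X)+r(Y) < r(E)+k).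
IsKSeparation : ∀ {r m} → Matrix r m → ℕ → Subset m → Set
IsKSeparation A k X =
  k ≤ ∣ X ∣ × k ≤ ∣ ∁ X ∣ ×
  (∃[ rX ] ∃[ rY ] ∃[ rE ]
     (IsRank A X rX × IsRank A (∁ X) rY × IsRank A ⊤ rE × rX + rY < rE + k))

NConnected : ∀ {r m} → ℕ → Matrix r m → Set
NConnected n A = ∀ k → 1 ≤ k → k < n → ∀ X → ¬ IsKSeparation A k X

CoSpansFails : ∀ {r m} → Matrix r m → Subset m → Set
CoSpansFails A Q = ∃[ a ] ∃[ b ] (IsRank A (∁ Q) a × IsRank A ⊤ b × a < b)

-- Q is a cocircuit of M[A]: a minimal set whose complement is non-spanning
-- (equivalently, a circuit of the dual matroid).
IsCocircuit : ∀ {r m} → Matrix r m → Subset m → Set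
IsCocircuit A Q = CoSpansFails A Q × (∀ Q′ → Q′ ⊆ Q → CoSpansFails A Q′ → Q′ ≡ Q)

-- Standard matrix representation [I_r | D] over GF(2), ground set Fin (r + k).
standard : ∀ {r k} → Matrix r k → Matrix r (r + k)
standard {r} D i j = [ (λ c → ⌊ i ≟ c ⌋) , (λ c → D i c) ] (splitAt r j)

-- The extra row and the extra column a are placed
-- at index zero (positions are only labels; the matroid is unaffected).
splitMatrix : ∀ {r m} → Matrix r m → Subset m → Matrix (suc r) (suc m)
splitMatrix A T zero    zero    = true
splitMatrix A T zero    (suc j) = lookup T j
splitMatrix A T (suc i) zero    = false
splitMatrix A T (suc i) (suc j) = A i j

module Submission where

-- M = M[A] for a standard representation A = [I_r | D] over GF(2); M′_T = M[A′],
-- where A′ adds the row T and a new column a = e₀.  Take a j-separation (X′, Y′)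
-- of M′_T with j < n, with a ∈ Y′ after swapping sides, and let X = X′, Y = E − X.
-- Independent sets of A stay independent in A′ (and gain a on the Y-side), while
-- r′(E′) ≤ r + 1 = r(E) + 1; so (X, Y) is a j-separation of M unless |Y| = j − 1.
-- In that case either adding the row T raises the rank of X, and (X, Y) is a
-- (j − 1)-separation of M, or T agrees on X with a cocycle C of M.  Every cocycle
-- is a disjoint union of cocircuits, so the hypothesis gives 2|C ∩ T| ≤ |C|, and
-- counting yields |T| ≤ |Y| = j − 1 < n − 1 = |T|.

open import Defs
open import Data.Nat using (ℕ; zero; suc; _+_; _*_; _∸_; _≤_; _<_; _≤?_; _<?_; z≤n; s≤s)
open import Data.Nat.Properties
  using (≤-refl; ≤-reflexive; ≤-trans; ≤-antisym; ≤-pred; <⇒≤; <⇒≱; ≰⇒>; <-trans; <-≤-trans;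
         +-comm; +-suc; +-identityʳ; +-mono-≤; +-monoˡ-≤; +-monoʳ-≤; +-cancelˡ-≤; *-distribˡ-+;
         m≤m+n; m≤n+m; m<n+m; m≤n+m∸n; m∸n≡0⇒m≤n; ∸-cancelʳ-≤; +-*-semiring; module ≤-Reasoning)
open import Data.Bool using (Bool; true; false; _∧_; _∨_; _xor_; not)
open import Data.Bool.Properties
  using (∧-comm; ∧-assoc; ∧-zeroʳ; ∧-identityʳ; ∧-distribʳ-xor; ∨-zeroʳ; ∨-identityʳ; xor-same;
         xor-identityʳ; xor-assoc; not-involutive; xor-∧-commutativeRing)
  renaming (_≟_ to _≟ᵇ_)
open import Data.Fin using (Fin; zero; suc; _≟_; _↑ˡ_)
open import Data.Fin.Properties using (any?; all?; splitAt-↑ˡ)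
open import Data.Fin.Subset using (Subset; _∩_; ∣_∣; Nonempty; _⊆_; ∁; ⊤; _∈_)
open import Data.Fin.Subset.Properties
  using (drop-there; drop-∷-⊆; anySubset?; nonempty?; _⊆?_; p⊆q⇒∣p∣≤∣q∣; ∣p∣≤n;
         ∣∁p∣≡n∸∣p∣; ∣p∣≡n⇒p≡⊤)
open import Data.Vec using ([]; _∷_; lookup; tabulate)
open import Data.Vec.Properties
  using (lookup∘tabulate; []=⇒lookup; lookup⇒[]=; lookup-map; lookup-replicate; lookup-zipWith)
open import Data.Product using (Σ; ∃; _×_; _,_; proj₁; proj₂)
open import Data.Sum using (_⊎_; inj₁; inj₂; [_,_])
open import Data.Empty using (⊥; ⊥-elim)
open import Function using (_∘_; case_of_)
open import Relation.Nullary using (¬_; Dec; yes; no)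
open import Relation.Nullary.Decidable using (⌊_⌋; _×-dec_; _→-dec_)
open import Relation.Binary.PropositionalEquality hiding ([_])
open import Algebra.Bundles using (CommutativeRing)
open import Data.Nat.Induction using (<-rec)
import Algebra.Properties.Semiring.Sum as Sums

variable
  r m : ℕ

-- A vector over GF(2) indexed by Fin m; it is also read as a subset of Fin m.
Bits : ℕ → Set
Bits m = Fin m → Bool

infix 8 _·_
_·_ : Bits m → Bits m → Bool
s · v = sumSel s v

-- Column e of a matrix B, and the cocycle of a functional y on the rows of B:
-- the columns e with y·(column e) = 1, i.e. the support of the row vector yB.
column : Matrix r m → Fin m → Bits r
column B e i = B i e

cocycle : Matrix r m → Bits r → Bits m
cocycle B y e = y · column B e

-- Sets of indices as bit vectors

false≢true : ¬ false ≡ true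
false≢true ()

true≢false : ¬ true ≡ false
true≢false ()

xor-cancelˡ : ∀ x y → x xor (x xor y) ≡ y
xor-cancelˡ x y = trans (sym (xor-assoc x x y)) (cong (_xor y) (xor-same x))

_⊆ᵇ_ : Bits m → Bits m → Set
S ⊆ᵇ I = ∀ j → S j ≡ true → I j ≡ true

NonEmpty : Bits m → Set
NonEmpty S = ∃ λ j → S j ≡ true

nonEmpty? : (S : Bits m) → Dec (NonEmpty S)
nonEmpty? S = any? (λ j → S j ≟ᵇ true)

¬nonEmpty⇒false : (S : Bits m) → ¬ NonEmpty S → ∀ j → S j ≡ false
¬nonEmpty⇒false S empty j with S j in eq
... | true  = ⊥-elim (empty (j , eq))
... | false = refl

⁅_⁆ᵇ : Fin m → Bits m
⁅ e ⁆ᵇ x = ⌊ x ≟ e ⌋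

⁅⁆-here : (e : Fin m) → ⁅ e ⁆ᵇ e ≡ true
⁅⁆-here e with e ≟ e
... | yes _ = refl
... | no e≢e = ⊥-elim (e≢e refl)

⁅⁆-elsewhere : {x e : Fin m} → ¬ x ≡ e → ⁅ e ⁆ᵇ x ≡ false
⁅⁆-elsewhere {x = x} {e} x≢e with x ≟ e
... | yes x≡e = ⊥-elim (x≢e x≡e)
... | no _    = refl

⁅⁆-suc : (p : Fin m) (j : Fin m) → ⁅ suc p ⁆ᵇ (suc j) ≡ ⁅ p ⁆ᵇ j
⁅⁆-suc p j with j ≟ p
... | yes _ = refl
... | no _  = refl

⁅⁆-sound : {x e : Fin m} → ⁅ e ⁆ᵇ x ≡ true → x ≡ e
⁅⁆-sound {x = x} {e} x∈⁅e⁆ with x ≟ e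
... | yes x≡e = x≡e

remove : Bits m → Fin m → Bits m
remove I e x = I x ∧ not (⁅ e ⁆ᵇ x)

remove⊆ : (I : Bits m) (p : Fin m) → remove I p ⊆ᵇ I
remove⊆ I p x with I x
... | true  = λ _ → refl
... | false = λ ()

remove-excludes : (I : Bits m) (p : Fin m) → remove I p p ≡ false
remove-excludes I p rewrite ⁅⁆-here p = ∧-zeroʳ (I p)

remove-keeps : (I : Bits m) {p j : Fin m} → I j ≡ true → ¬ j ≡ p → remove I p j ≡ true
remove-keeps I {p} {j} Ij j≢p rewrite Ij | ⁅⁆-elsewhere j≢p = refl

insert : Bits m → Fin m → Bits m
insert I e x = I x ∨ ⁅ e ⁆ᵇ x

insert-here : (J : Bits m) (e : Fin m) → insert J e e ≡ true
insert-here J e rewrite ⁅⁆-here e = ∨-zeroʳ (J e)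

insert-elsewhere : (J : Bits m) {e x : Fin m} → ¬ x ≡ e → insert J e x ≡ J x
insert-elsewhere J {e} {x} x≢e rewrite ⁅⁆-elsewhere x≢e = ∨-identityʳ (J x)

insert⊆ : {J X : Bits m} {e : Fin m} → J ⊆ᵇ X → X e ≡ true → insert J e ⊆ᵇ X
insert⊆ {J = J} {X} {e} J⊆X Xe x x∈J+e = case x ≟ e of λ where
  (yes refl) → Xe
  (no x≢e)   → J⊆X x (trans (sym (insert-elsewhere J x≢e)) x∈J+e)

⊆insert-avoiding : {S J : Bits m} {e : Fin m} → S ⊆ᵇ insert J e → S e ≡ false → S ⊆ᵇ J
⊆insert-avoiding {S = S} {J} {e} S⊆J+e Se x Sx = case x ≟ e of λ where
  (yes refl) → ⊥-elim (false≢true (trans (sym Se) Sx))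
  (no x≢e)   → trans (sym (insert-elsewhere J x≢e)) (S⊆J+e x Sx)

⊆insert-toggle : {S J : Bits m} {e : Fin m} → S ⊆ᵇ insert J e → S e ≡ true →
                 (λ x → ⁅ e ⁆ᵇ x xor S x) ⊆ᵇ J
⊆insert-toggle {S = S} {J} {e} S⊆J+e Se x x∈S−e = case x ≟ e of λ where
  (yes refl) → ⊥-elim (false≢true (trans (sym (cong₂ _xor_ (⁅⁆-here e) Se)) x∈S−e))
  (no x≢e)   → trans (sym (insert-elsewhere J x≢e))
                     (S⊆J+e x (trans (sym (cong (_xor S x) (⁅⁆-elsewhere x≢e))) x∈S−e))

∈⇒true : {x : Fin m} {S : Subset m} → x ∈ S → lookup S x ≡ true
∈⇒true = []=⇒lookup

true⇒∈ : {x : Fin m} {S : Subset m} → lookup S x ≡ true → x ∈ S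
true⇒∈ {x = x} {S} = lookup⇒[]= x S

⊆⇒⊆ᵇ : {S I : Subset m} → S ⊆ I → lookup S ⊆ᵇ lookup I
⊆⇒⊆ᵇ S⊆I j Sj = ∈⇒true (S⊆I (true⇒∈ Sj))

⊆ᵇ⇒⊆ : {S I : Subset m} → lookup S ⊆ᵇ lookup I → S ⊆ I
⊆ᵇ⇒⊆ S⊆I {x} x∈S = true⇒∈ (S⊆I x (∈⇒true x∈S))

lookup-∁ : (X : Subset m) (e : Fin m) → lookup (∁ X) e ≡ not (lookup X e)
lookup-∁ X e = lookup-map e not X

lookup-⊤ : (e : Fin m) → lookup (⊤ {m}) e ≡ true
lookup-⊤ e = lookup-replicate e true

∁-involutive : (X : Subset m) → ∁ (∁ X) ≡ X
∁-involutive []      = refl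
∁-involutive (x ∷ X) = cong₂ _∷_ (not-involutive x) (∁-involutive X)

-- Sums over GF(2): the dot product is a library sum of products, so
-- linearity and the exchange of double sums come from the library.

module GF2 = Sums (CommutativeRing.semiring xor-∧-commutativeRing)

·-as-∑ : (s v : Bits m) → s · v ≡ GF2.sum (λ j → s j ∧ v j)
·-as-∑ {zero}  s v = refl
·-as-∑ {suc m} s v = cong ((s zero ∧ v zero) xor_) (·-as-∑ (s ∘ suc) (v ∘ suc))


·-zeroˡ : (s v : Bits m) → (∀ j → s j ≡ false) → s · v ≡ false
·-zeroˡ {zero}  s v s≡0 = refl
·-zeroˡ {suc m} s v s≡0 rewrite s≡0 zero = ·-zeroˡ (s ∘ suc) (v ∘ suc) (s≡0 ∘ suc)

module _ {m : ℕ} where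
  open ≡-Reasoning

  ·-termwise : {s s′ v v′ : Bits m} → (∀ j → s j ∧ v j ≡ s′ j ∧ v′ j) → s · v ≡ s′ · v′
  ·-termwise {s} {s′} {v} {v′} same = begin
    s · v                         ≡⟨ ·-as-∑ s v ⟩
    GF2.sum (λ j → s j ∧ v j)     ≡⟨ GF2.sum-cong-≗ same ⟩
    GF2.sum (λ j → s′ j ∧ v′ j)   ≡⟨ sym (·-as-∑ s′ v′) ⟩
    s′ · v′                       ∎

  ·-cong : {s s′ v v′ : Bits m} → (∀ j → s j ≡ s′ j) → (∀ j → v j ≡ v′ j) → s · v ≡ s′ · v′
  ·-cong s≗s′ v≗v′ = ·-termwise (λ j → cong₂ _∧_ (s≗s′ j) (v≗v′ j))

  ·-comm : (s v : Bits m) → s · v ≡ v · s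
  ·-comm s v = ·-termwise (λ j → ∧-comm (s j) (v j))

  ·-agree : (s v w : Bits m) → (∀ j → s j ≡ true → v j ≡ w j) → s · v ≡ s · w
  ·-agree s v w agree = ·-termwise (λ j → masked (s j) (agree j))
    where
    masked : ∀ a {b c} → (a ≡ true → b ≡ c) → a ∧ b ≡ a ∧ c
    masked true  b≡c = b≡c refl
    masked false _   = refl

  ·-zeroʳ : (s v : Bits m) → (∀ j → v j ≡ false) → s · v ≡ false
  ·-zeroʳ s v v≡0 = trans (·-comm s v) (·-zeroˡ v s v≡0)

  ·-xorˡ : (s s′ v : Bits m) → (λ j → s j xor s′ j) · v ≡ s · v xor s′ · v
  ·-xorˡ s s′ v = begin
    (λ j → s j xor s′ j) · v                        ≡⟨ ·-as-∑ _ v ⟩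
    GF2.sum (λ j → (s j xor s′ j) ∧ v j)            ≡⟨ GF2.sum-cong-≗ (λ j → ∧-distribʳ-xor (v j) (s j) (s′ j)) ⟩
    GF2.sum (λ j → (s j ∧ v j) xor (s′ j ∧ v j))    ≡⟨ GF2.∑-distrib-+ (λ j → s j ∧ v j) (λ j → s′ j ∧ v j) ⟩
    GF2.sum (λ j → s j ∧ v j) xor GF2.sum (λ j → s′ j ∧ v j)
                                                    ≡⟨ sym (cong₂ _xor_ (·-as-∑ s v) (·-as-∑ s′ v)) ⟩
    s · v xor s′ · v                                ∎

  ·-xorʳ : (s v v′ : Bits m) → s · (λ j → v j xor v′ j) ≡ s · v xor s · v′
  ·-xorʳ s v v′ = trans (·-comm s _) (trans (·-xorˡ v v′ s) (cong₂ _xor_ (·-comm v s) (·-comm v′ s)))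

  ·-scalarˡ : (c : Bool) (s v : Bits m) → (λ j → c ∧ s j) · v ≡ c ∧ s · v
  ·-scalarˡ c s v = begin
    (λ j → c ∧ s j) · v                ≡⟨ ·-as-∑ _ v ⟩
    GF2.sum (λ j → (c ∧ s j) ∧ v j)    ≡⟨ GF2.sum-cong-≗ (λ j → ∧-assoc c (s j) (v j)) ⟩
    GF2.sum (λ j → c ∧ (s j ∧ v j))    ≡⟨ sym (GF2.*-distribˡ-sum c (λ j → s j ∧ v j)) ⟩
    c ∧ GF2.sum (λ j → s j ∧ v j)      ≡⟨ cong (c ∧_) (sym (·-as-∑ s v)) ⟩
    c ∧ s · v                          ∎

  ·-scalarʳ : (c : Bool) (s v : Bits m) → s · (λ j → c ∧ v j) ≡ c ∧ s · v
  ·-scalarʳ c s v = trans (·-comm s _) (trans (·-scalarˡ c v s) (cong (c ∧_) (·-comm v s)))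

·-singletonˡ : (p : Fin m) (v : Bits m) → ⁅ p ⁆ᵇ · v ≡ v p
·-singletonˡ {suc m} zero v =
  trans (cong (v zero xor_) (·-zeroˡ (λ j → ⁅ zero ⁆ᵇ (suc j)) (v ∘ suc) (λ j → refl)))
        (xor-identityʳ (v zero))
·-singletonˡ {suc m} (suc p) v =
  trans (·-cong (⁅⁆-suc p) (λ _ → refl)) (·-singletonˡ p (v ∘ suc))

·-singletonʳ : (p : Fin m) (v : Bits m) → v · ⁅ p ⁆ᵇ ≡ v p
·-singletonʳ p v = trans (·-comm v _) (·-singletonˡ p v)

·-exchange : (y : Bits r) (s : Bits m) (B : Matrix r m) →
             y · (λ i → s · B i) ≡ s · cocycle B y
·-exchange {zero}  y s B = sym (·-zeroʳ s _ (λ _ → refl))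
·-exchange {suc r} y s B =
  trans (cong₂ _xor_ (sym (·-scalarʳ (y zero) s (B zero))) (·-exchange (y ∘ suc) s (B ∘ suc)))
        (sym (·-xorʳ s _ _))

cocycle-xor : (B : Matrix r m) (y y′ : Bits r) (e : Fin m) →
              cocycle B (λ i → y i xor y′ i) e ≡ cocycle B y e xor cocycle B y′ e
cocycle-xor B y y′ e = ·-xorˡ y y′ (column B e)

cocycle-on-sum : (B : Matrix r m) (y : Bits r) (S : Bits m) {e : Fin m} →
                 (∀ i → S · B i ≡ B i e) → cocycle B y e ≡ S · cocycle B y
cocycle-on-sum B y S {e} e=ΣS = trans (·-cong (λ _ → refl) (sym ∘ e=ΣS)) (·-exchange y S B)

module ℕΣ = Sums +-*-semiring

bit : Bool → ℕ
bit true  = 1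
bit false = 0

count : Bits m → ℕ
count S = ℕΣ.sum (λ j → bit (S j))

count-cong : (S S′ : Bits m) → (∀ j → S j ≡ S′ j) → count S ≡ count S′
count-cong S S′ S≗S′ = ℕΣ.sum-cong-≗ (λ j → cong bit (S≗S′ j))

count-card : (S : Subset m) → ∣ S ∣ ≡ count (lookup S)
count-card []          = refl
count-card (true ∷ S)  = cong suc (count-card S)
count-card (false ∷ S) = count-card S

count-all : (m : ℕ) → count {m} (λ _ → true) ≡ m
count-all zero    = refl
count-all (suc m) = cong suc (count-all m)

count-empty : (S : Bits m) → (∀ j → S j ≡ false) → count S ≡ 0
count-empty {zero}  S S≡0 = refl
count-empty {suc m} S S≡0 rewrite S≡0 zero = count-empty (S ∘ suc) (S≡0 ∘ suc)

count-nonEmpty : (S : Bits m) → NonEmpty S → 1 ≤ count S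
count-nonEmpty {suc m} S (zero  , S0) rewrite S0 = s≤s z≤n
count-nonEmpty {suc m} S (suc j , Sj) =
  ≤-trans (count-nonEmpty (S ∘ suc) (j , Sj)) (m≤n+m _ (bit (S zero)))

ℕΣ-mono : {f g : Fin m → ℕ} → (∀ j → f j ≤ g j) → ℕΣ.sum f ≤ ℕΣ.sum g
ℕΣ-mono {zero}  f≤g = z≤n
ℕΣ-mono {suc m} f≤g = +-mono-≤ (f≤g zero) (ℕΣ-mono (f≤g ∘ suc))

count-remove : (I : Bits m) (p : Fin m) → I p ≡ true → count I ≡ suc (count (remove I p))
count-remove {suc m} I zero Ip rewrite Ip =
  cong suc (count-cong _ _ (λ j → sym (∧-identityʳ (I (suc j)))))
count-remove {suc m} I (suc p) Ip = begin
  bit (I zero) + count (I ∘ suc)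
    ≡⟨ cong₂ _+_ (cong bit (sym (∧-identityʳ (I zero)))) (count-remove (I ∘ suc) p Ip) ⟩
  bit (I zero ∧ true) + suc (count (remove (I ∘ suc) p))
    ≡⟨ +-suc _ _ ⟩
  suc (bit (I zero ∧ true) + count (remove (I ∘ suc) p))
    ≡⟨ cong (λ c → suc (bit (I zero ∧ true) + c))
            (count-cong _ _ (λ j → cong (λ b → I (suc j) ∧ not b) (sym (⁅⁆-suc p j)))) ⟩
  suc (count (remove I (suc p))) ∎
  where open ≡-Reasoning

count-insert : (I : Bits m) (e : Fin m) → I e ≡ false → count (insert I e) ≡ suc (count I)
count-insert I e Ie = trans (count-remove (insert I e) e (insert-here I e)) (cong suc (count-cong _ _ removed))
  where
  removed : ∀ x → remove (insert I e) e x ≡ I x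
  removed x with x ≟ e
  ... | yes refl = trans (∧-zeroʳ _) (sym Ie)
  ... | no _     = trans (∧-identityʳ _) (∨-identityʳ (I x))

count-split : (A A′ : Bits m) → A′ ⊆ᵇ A → count A ≡ count A′ + count (λ j → A j xor A′ j)
count-split A A′ A′⊆A =
  trans (ℕΣ.sum-cong-≗ (λ j → bit-split (A j) (A′ j) (A′⊆A j)))
        (ℕΣ.∑-distrib-+ (λ j → bit (A′ j)) (λ j → bit (A j xor A′ j)))
  where
  bit-split : ∀ a a′ → (a′ ≡ true → a ≡ true) → bit a ≡ bit a′ + bit (a xor a′)
  bit-split true  true  _ = refl
  bit-split true  false _ = refl
  bit-split false true  a′⇒a = ⊥-elim (false≢true (a′⇒a refl))
  bit-split false false _ = refl

-- If C agrees with T on X, then |T| + |C| ≤ 2|C ∩ T| + |E − X| (count pointwise: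
-- inside X an element lies in both or neither of C and T).
agreement-count : (C T X : Bits m) → (∀ e → X e ≡ true → C e ≡ T e) →
                  count T + count C ≤ 2 * count (λ e → C e ∧ T e) + count (not ∘ X)
agreement-count C T X agree = begin
  count T + count C
    ≡⟨ sym (ℕΣ.∑-distrib-+ (bit ∘ T) (bit ∘ C)) ⟩
  ℕΣ.sum (λ e → bit (T e) + bit (C e))
    ≤⟨ ℕΣ-mono (λ e → pointwise (X e) (C e) (T e) (agree e)) ⟩
  ℕΣ.sum (λ e → 2 * bit (C e ∧ T e) + bit (not (X e)))
    ≡⟨ ℕΣ.∑-distrib-+ (λ e → 2 * bit (C e ∧ T e)) (bit ∘ not ∘ X) ⟩
  ℕΣ.sum (λ e → 2 * bit (C e ∧ T e)) + count (not ∘ X)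
    ≡⟨ cong (_+ count (not ∘ X)) (sym (ℕΣ.*-distribˡ-sum 2 (λ e → bit (C e ∧ T e)))) ⟩
  2 * count (λ e → C e ∧ T e) + count (not ∘ X) ∎
  where
  open ≤-Reasoning
  pointwise : ∀ x c t → (x ≡ true → c ≡ t) → bit t + bit c ≤ 2 * bit (c ∧ t) + bit (not x)
  pointwise true  true  true  _ = ≤-refl
  pointwise true  false false _ = ≤-refl
  pointwise true  true  false c≡t = ⊥-elim (true≢false (c≡t refl))
  pointwise true  false true  c≡t = ⊥-elim (false≢true (c≡t refl))
  pointwise false true  true  _ = s≤s (s≤s z≤n)
  pointwise false true  false _ = ≤-refl
  pointwise false false true  _ = ≤-refl
  pointwise false false false _ = z≤n

-- Linear (in)dependence of columns over GF(2)

IsDependency : Matrix r m → Bits m → Bits m → Set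
IsDependency B I S = S ⊆ᵇ I × NonEmpty S × (∀ i → S · B i ≡ false)

Dependent : Matrix r m → Bits m → Set
Dependent B I = ∃ (IsDependency B I)

LinIndep : Matrix r m → Bits m → Set
LinIndep B I = ¬ Dependent B I

isDependency-resp : (B : Matrix r m) (I : Bits m) {S S′ : Bits m} →
                    (∀ j → S j ≡ S′ j) → IsDependency B I S → IsDependency B I S′
isDependency-resp B I S≗S′ (S⊆I , (j , Sj) , sums) =
  (λ x S′x → S⊆I x (trans (S≗S′ x) S′x)) , (j , trans (sym (S≗S′ j)) Sj) ,
  (λ i → trans (·-cong (sym ∘ S≗S′) (λ _ → refl)) (sums i))

dependent? : (B : Matrix r m) (I : Bits m) → Dec (Dependent B I)
dependent? B I with anySubset? (λ S → isDependency? (lookup S))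
  where
  isDependency? : (S : Bits _) → Dec (IsDependency B I S)
  isDependency? S = all? (λ j → (S j ≟ᵇ true) →-dec (I j ≟ᵇ true)) ×-dec
                    (nonEmpty? S ×-dec all? (λ i → S · B i ≟ᵇ false))
... | yes (S , dep) = yes (lookup S , dep)
... | no none = no λ (S , dep) →
        none (tabulate S , isDependency-resp B I (sym ∘ lookup∘tabulate S) dep)

independent⇒linIndep : {B : Matrix r m} {I : Subset m} → Independent B I → LinIndep B (lookup I)
independent⇒linIndep {B = B} {I} ind (S , dep) with isDependency-resp B (lookup I) (sym ∘ lookup∘tabulate S) dep
... | S⊆I , (j , Sj) , sums = ind (tabulate S) (⊆ᵇ⇒⊆ S⊆I) (j , true⇒∈ Sj) sums

linIndep⇒independent : {B : Matrix r m} {I : Subset m} → LinIndep B (lookup I) → Independent B I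
linIndep⇒independent indep S S⊆I (j , j∈S) sums = indep (lookup S , ⊆⇒⊆ᵇ S⊆I , (j , ∈⇒true j∈S) , sums)

linIndep-⊆ : {B : Matrix r m} {I J : Bits m} → LinIndep B I → J ⊆ᵇ I → LinIndep B J
linIndep-⊆ indep J⊆I (S , S⊆J , nonEmpty , sums) = indep (S , (λ j → J⊆I j ∘ S⊆J j) , nonEmpty , sums)

linIndep-addRow : {B : Matrix (suc r) m} {I : Bits m} → LinIndep (B ∘ suc) I → LinIndep B I
linIndep-addRow indep (S , S⊆I , nonEmpty , sums) = indep (S , S⊆I , nonEmpty , sums ∘ suc)

linIndep-dropZeroRow : {B : Matrix (suc r) m} {I : Bits m} → LinIndep B I →
                       (∀ j → I j ≡ true → B zero j ≡ false) → LinIndep (B ∘ suc) I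
linIndep-dropZeroRow {B = B} indep row0≡0 (S , S⊆I , nonEmpty , sums) = indep (S , S⊆I , nonEmpty , sums′)
  where
  sums′ : ∀ i → S · B i ≡ false
  sums′ zero    = trans (·-agree S (B zero) (λ _ → false) (λ j → row0≡0 j ∘ S⊆I j)) (·-zeroʳ S _ (λ _ → refl))
  sums′ (suc i) = sums i

linIndep-noRows : {B : Matrix 0 m} {I : Bits m} → LinIndep B I → ∀ j → I j ≡ false
linIndep-noRows {I = I} indep j with I j in Ij
... | false = refl
... | true  = ⊥-elim (indep (⁅ j ⁆ᵇ , (λ x x≡j → subst (λ y → I y ≡ true) (sym (⁅⁆-sound x≡j)) Ij) ,
                              (j , ⁅⁆-here j) , λ ()))

-- Gaussian elimination

pivot? : (I b : Bits m) → (∃ λ p → I p ≡ true × b p ≡ true) ⊎ (∀ j → I j ≡ true → b j ≡ false)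
pivot? I b with any? (λ p → (I p ∧ b p) ≟ᵇ true)
... | yes (p , Ip∧bp) = inj₁ (p , ∧-true Ip∧bp)
  where
  ∧-true : ∀ {x y} → x ∧ y ≡ true → x ≡ true × y ≡ true
  ∧-true {true} {true} _ = refl , refl
... | no none = inj₂ vanishes
  where
  vanishes : ∀ j → I j ≡ true → b j ≡ false
  vanishes j Ij with b j in bj
  ... | false = refl
  ... | true  = ⊥-elim (none (j , trans (cong (_∧ b j) Ij) bj))

-- Clearing column p from the rows below the pivot row 0 (pivot entry B 0 p = 1).
eliminate : Matrix (suc r) m → Fin m → Matrix r m
eliminate B p i j = (B (suc i) p ∧ B zero j) xor B (suc i) j

toggle-elsewhere : (c : Bool) (S : Bits m) {p x : Fin m} → ¬ x ≡ p → (c ∧ ⁅ p ⁆ᵇ x) xor S x ≡ S x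
toggle-elsewhere c S x≢p rewrite ⁅⁆-elsewhere x≢p | ∧-zeroʳ c = refl

-- Elimination keeps the remaining pivot-free columns independent: a dependency
-- S of the eliminated matrix lifts to the dependency (S·B₀){p} + S of B.
eliminate-linIndep : {B : Matrix (suc r) m} {I : Bits m} {p : Fin m} → LinIndep B I →
                     I p ≡ true → B zero p ≡ true → LinIndep (eliminate B p) (remove I p)
eliminate-linIndep {B = B} {I} {p} indep Ip pivot (S , S⊆I−p , (j , Sj) , sums) =
  indep (lift , lift⊆I , (j , lift-j) , lift-sums)
  where
  open ≡-Reasoning
  c : Bool
  c = S · B zero
  lift : Bits _
  lift x = (c ∧ ⁅ p ⁆ᵇ x) xor S x
  lift-· : ∀ v → lift · v ≡ (c ∧ v p) xor S · v
  lift-· v = trans (·-xorˡ _ S v) (cong (_xor S · v) (trans (·-scalarˡ c _ v) (cong (c ∧_) (·-singletonˡ p v))))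
  avoids-p : ∀ {x} → S x ≡ true → ¬ x ≡ p
  avoids-p Sx refl with trans (sym (S⊆I−p p Sx)) (remove-excludes I p)
  ... | ()
  lift⊆I : lift ⊆ᵇ I
  lift⊆I x lx with x ≟ p
  ... | yes refl = Ip
  ... | no _     = remove⊆ I p x (S⊆I−p x (trans (cong (_xor S x) (sym (∧-zeroʳ c))) lx))
  lift-j : lift j ≡ true
  lift-j = trans (toggle-elsewhere c S (avoids-p Sj)) Sj
  lift-sums : ∀ i → lift · B i ≡ false
  lift-sums zero = begin
    lift · B zero                 ≡⟨ lift-· (B zero) ⟩
    (c ∧ B zero p) xor c          ≡⟨ cong (λ b → (c ∧ b) xor c) pivot ⟩
    (c ∧ true) xor c              ≡⟨ cong (_xor c) (∧-identityʳ c) ⟩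
    c xor c                       ≡⟨ xor-same c ⟩
    false                         ∎
  lift-sums (suc i) = begin
    lift · B (suc i)                                  ≡⟨ lift-· (B (suc i)) ⟩
    (c ∧ b) xor S · B (suc i)                         ≡⟨ cong (_xor S · B (suc i)) (∧-comm c b) ⟩
    (b ∧ S · B zero) xor S · B (suc i)                ≡⟨ cong (_xor S · B (suc i)) (sym (·-scalarʳ b S (B zero))) ⟩
    S · (λ j → b ∧ B zero j) xor S · B (suc i)        ≡⟨ sym (·-xorʳ S (λ j → b ∧ B zero j) (B (suc i))) ⟩
    S · eliminate B p i                               ≡⟨ sums i ⟩
    false                                             ∎
    where
    b : Bool
    b = B (suc i) p

-- Independent columns supported on the rows R are at most |R| in number.
-- (Induction on the rows: a pivot in row 0 is removed together with one
-- column by elimination; without a pivot, row 0 is deleted.)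
linIndep≤support : (B : Matrix r m) (I : Bits m) (R : Bits r) →
                   (∀ i → R i ≡ false → ∀ j → I j ≡ true → B i j ≡ false) →
                   LinIndep B I → count I ≤ count R
linIndep≤support {zero} B I R _ indep = ≤-reflexive (count-empty I (linIndep-noRows indep))
linIndep≤support {suc r} B I R supported indep with pivot? I (B zero)
... | inj₂ row0≡0 =
  ≤-trans (linIndep≤support (B ∘ suc) I (R ∘ suc) (supported ∘ suc) (linIndep-dropZeroRow indep row0≡0))
          (m≤n+m _ (bit (R zero)))
... | inj₁ (p , Ip , pivot) with R zero in R0
...   | false = ⊥-elim (true≢false (trans (sym pivot) (supported zero R0 p Ip)))
...   | true  = subst (_≤ suc (count (R ∘ suc))) (sym (count-remove I p Ip))
                  (s≤s (linIndep≤support (eliminate B p) (remove I p) (R ∘ suc) supported′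
                                         (eliminate-linIndep indep Ip pivot)))
  where
  supported′ : ∀ i → R (suc i) ≡ false → ∀ j → remove I p j ≡ true → eliminate B p i j ≡ false
  supported′ i Ri j Ij rewrite supported (suc i) Ri j (remove⊆ I p j Ij) | supported (suc i) Ri p Ip = refl

-- Fewer than r columns are annihilated by a nonzero functional on the rows:
-- otherwise the r rows, restricted to I, would be independent, giving r ≤ |I|.
annihilator : (B : Matrix r m) (I : Bits m) → count I < r →
              ∃ λ y → NonEmpty y × (∀ j → I j ≡ true → cocycle B y j ≡ false)
annihilator {r} B I |I|<r with dependent? rowsOnI (λ _ → true)
  where
  rowsOnI : Matrix _ r
  rowsOnI j i = I j ∧ B i j
... | yes (y , _ , nonEmpty , sums) =
  y , nonEmpty , λ j Ij → trans (·-cong (λ _ → refl) (λ i → cong (_∧ B i j) (sym Ij))) (sums j)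
... | no indep = ⊥-elim (<⇒≱ |I|<r (subst (_≤ count I) (count-all r)
                   (linIndep≤support _ (λ _ → true) I offI indep)))
  where
  offI : ∀ j → I j ≡ false → ∀ i → _ → I j ∧ B i j ≡ false
  offI j Ij i _ rewrite Ij = refl

_◂_ : Bool → Bits r → Bits (suc r)
(a ◂ y) zero    = a
(a ◂ y) (suc i) = y i

interpolate-lift : (B : Matrix (suc r) m) (I t : Bits m) {p : Fin m} → B zero p ≡ true → (y : Bits r) →
                   (∀ j → remove I p j ≡ true → cocycle (eliminate B p) y j ≡ (t p ∧ B zero j) xor t j) →
                   ∀ j → I j ≡ true → cocycle B ((t p xor cocycle (B ∘ suc) y p) ◂ y) j ≡ t j
interpolate-lift B I t {p} pivot y fits j Ij = lifted (j ≟ p)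
  where
  open ≡-Reasoning
  s : Bits _
  s = cocycle (B ∘ suc) y
  y⁺ : Bits _
  y⁺ = (t p xor s p) ◂ y
  at-pivot : cocycle B y⁺ p ≡ t p
  at-pivot = begin
    ((t p xor s p) ∧ B zero p) xor s p  ≡⟨ cong (λ b → ((t p xor s p) ∧ b) xor s p) pivot ⟩
    ((t p xor s p) ∧ true) xor s p      ≡⟨ cong (_xor s p) (∧-identityʳ (t p xor s p)) ⟩
    (t p xor s p) xor s p               ≡⟨ xor-assoc (t p) (s p) (s p) ⟩
    t p xor (s p xor s p)               ≡⟨ cong (t p xor_) (xor-same (s p)) ⟩
    t p xor false                       ≡⟨ xor-identityʳ (t p) ⟩
    t p                                 ∎
  eliminated : ¬ j ≡ p → (s p ∧ B zero j) xor s j ≡ (t p ∧ B zero j) xor t j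
  eliminated j≢p = begin
    (s p ∧ b) xor s j                               ≡⟨ cong (_xor s j) (∧-comm (s p) b) ⟩
    (b ∧ s p) xor s j                               ≡⟨ cong (_xor s j) (sym (·-scalarʳ b y (column (B ∘ suc) p))) ⟩
    y · (λ i → b ∧ B (suc i) p) xor s j             ≡⟨ sym (·-xorʳ y _ (column (B ∘ suc) j)) ⟩
    y · (λ i → (b ∧ B (suc i) p) xor B (suc i) j)   ≡⟨ ·-cong (λ _ → refl) (λ i → cong (_xor B (suc i) j) (∧-comm b _)) ⟩
    cocycle (eliminate B p) y j                     ≡⟨ fits j (remove-keeps I Ij j≢p) ⟩
    (t p ∧ b) xor t j                               ∎
    where
    b : Bool
    b = B zero j
  lifted : Dec (j ≡ p) → cocycle B y⁺ j ≡ t j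
  lifted (yes j≡p) = subst (λ x → cocycle B y⁺ x ≡ t x) (sym j≡p) at-pivot
  lifted (no j≢p)  = begin
    ((t p xor s p) ∧ B zero j) xor s j                    ≡⟨ cong (_xor s j) (∧-distribʳ-xor (B zero j) (t p) (s p)) ⟩
    ((t p ∧ B zero j) xor (s p ∧ B zero j)) xor s j       ≡⟨ xor-assoc (t p ∧ B zero j) _ (s j) ⟩
    (t p ∧ B zero j) xor ((s p ∧ B zero j) xor s j)       ≡⟨ cong ((t p ∧ B zero j) xor_) (eliminated j≢p) ⟩
    (t p ∧ B zero j) xor ((t p ∧ B zero j) xor t j)       ≡⟨ xor-cancelˡ (t p ∧ B zero j) (t j) ⟩
    t j                                                   ∎

-- Any values t can be prescribed on an independent set I of columns: some
-- functional y has cocycle equal to t on I.  (Induction on the rows,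
-- eliminating a pivot of row 0 when there is one.)
interpolate : (B : Matrix r m) (I t : Bits m) → LinIndep B I →
              ∃ λ y → ∀ j → I j ≡ true → cocycle B y j ≡ t j
interpolate {zero} B I t indep = (λ ()) , λ j Ij → ⊥-elim (true≢false (trans (sym Ij) (linIndep-noRows indep j)))
interpolate {suc r} B I t indep with pivot? I (B zero)
... | inj₂ row0≡0 with interpolate (B ∘ suc) I t (linIndep-dropZeroRow indep row0≡0)
...   | y , fits = false ◂ y , fits
interpolate {suc r} B I t indep | inj₁ (p , Ip , pivot)
  with interpolate (eliminate B p) (remove I p) (λ j → (t p ∧ B zero j) xor t j) (eliminate-linIndep indep Ip pivot)
... | y , fits = (t p xor cocycle (B ∘ suc) y p) ◂ y , interpolate-lift B I t pivot y fits


-- Finite search over the subsets of Fin m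

maximise : (P : Subset m → Set) → (∀ S → Dec (P S)) → (μ : Subset m → ℕ) →
           (∀ S → ¬ P S) ⊎ (Σ (Subset m) λ S → P S × (∀ S′ → P S′ → μ S′ ≤ μ S))
maximise {zero} P P? μ with P? []
... | yes p = inj₂ ([] , p , λ { [] _ → ≤-refl })
... | no ¬p = inj₁ λ { [] → ¬p }
maximise {suc m} P P? μ
  with maximise (P ∘ (true ∷_)) (P? ∘ (true ∷_)) (μ ∘ (true ∷_))
     | maximise (P ∘ (false ∷_)) (P? ∘ (false ∷_)) (μ ∘ (false ∷_))
... | inj₁ none₁ | inj₁ none₀ = inj₁ λ { (true ∷ S) → none₁ S ; (false ∷ S) → none₀ S }
... | inj₂ (S₁ , p₁ , max₁) | inj₁ none₀ =
  inj₂ (true ∷ S₁ , p₁ , λ { (true ∷ S) q → max₁ S q ; (false ∷ S) q → ⊥-elim (none₀ S q) })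
... | inj₁ none₁ | inj₂ (S₀ , p₀ , max₀) =
  inj₂ (false ∷ S₀ , p₀ , λ { (true ∷ S) q → ⊥-elim (none₁ S q) ; (false ∷ S) q → max₀ S q })
... | inj₂ (S₁ , p₁ , max₁) | inj₂ (S₀ , p₀ , max₀) with μ (true ∷ S₁) ≤? μ (false ∷ S₀)
...   | yes ≤₀ = inj₂ (false ∷ S₀ , p₀ , λ { (true ∷ S) q → ≤-trans (max₁ S q) ≤₀
                                          ; (false ∷ S) q → max₀ S q })
...   | no ≰₀  = inj₂ (true ∷ S₁ , p₁ , λ { (true ∷ S) q → max₁ S q
                                          ; (false ∷ S) q → ≤-trans (max₀ S q) (<⇒≤ (≰⇒> ≰₀)) })

smallest : (P : Subset m → Set) → (∀ S → Dec (P S)) →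
           (∀ S → ¬ P S) ⊎ (Σ (Subset m) λ S → P S × (∀ S′ → P S′ → ∣ S ∣ ≤ ∣ S′ ∣))
smallest {m} P P? with maximise P P? (λ S → m ∸ ∣ S ∣)
... | inj₁ none = inj₁ none
... | inj₂ (S , p , max) = inj₂ (S , p , λ S′ q → ∸-cancelʳ-≤ (∣p∣≤n S) (max S′ q))

⊆-size-equal : (P Q : Subset m) → P ⊆ Q → ∣ Q ∣ ≤ ∣ P ∣ → P ≡ Q
⊆-size-equal [] [] _ _ = refl
⊆-size-equal (a ∷ P) (b ∷ Q) P⊆Q |Q|≤|P| with a | b | ⊆⇒⊆ᵇ {S = a ∷ P} {I = b ∷ Q} P⊆Q zero
... | true  | true  | _ = cong (true ∷_) (⊆-size-equal P Q (drop-∷-⊆ P⊆Q) (≤-pred |Q|≤|P|))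
... | false | false | _ = cong (false ∷_) (⊆-size-equal P Q (drop-∷-⊆ P⊆Q) |Q|≤|P|)
... | true  | false | a⇒b with a⇒b refl
...   | ()
⊆-size-equal (a ∷ P) (b ∷ Q) P⊆Q |Q|≤|P| | false | true | _ =
  ⊥-elim (<⇒≱ |Q|≤|P| (p⊆q⇒∣p∣≤∣q∣ (drop-∷-⊆ P⊆Q)))

-- Rank

independent? : (B : Matrix r m) (I : Subset m) → Dec (Independent B I)
independent? B I with dependent? B (lookup I)
... | yes dep = no (λ ind → independent⇒linIndep ind dep)
... | no indep = yes (linIndep⇒independent indep)

rank : (B : Matrix r m) (X : Subset m) → Σ ℕ (IsRank B X)
rank {m = m} B X with maximise (λ I → I ⊆ X × Independent B I) (λ I → (I ⊆? X) ×-dec independent? B I) ∣_∣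
... | inj₂ (I , (I⊆X , indep) , largest) =
  ∣ I ∣ , (I , I⊆X , indep , refl) , λ J J⊆X J-indep → largest J (J⊆X , J-indep)
... | inj₁ none = ⊥-elim (none empty (⊆ᵇ⇒⊆ (λ j → ⊥-elim ∘ nothing j) ,
                                    linIndep⇒independent (λ (S , S⊆∅ , (j , Sj) , _) → nothing j (S⊆∅ j Sj))))
  where
  empty : Subset m
  empty = tabulate (λ _ → false)
  nothing : ∀ j → lookup empty j ≡ true → ⊥
  nothing j j∈∅ with trans (sym (lookup∘tabulate (λ _ → false) j)) j∈∅
  ... | ()

rank-unique : {B : Matrix r m} {X : Subset m} {a b : ℕ} → IsRank B X a → IsRank B X b → a ≡ b
rank-unique ((I , I⊆X , I-indep , refl) , largestᵃ) ((J , J⊆X , J-indep , refl) , largestᵇ) =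
  ≤-antisym (largestᵇ I I⊆X I-indep) (largestᵃ J J⊆X J-indep)

module _ {B : Matrix r m} {X : Subset m} {ρ : ℕ} (R : IsRank B X ρ) where

  rank-bound : (J : Bits m) → J ⊆ᵇ lookup X → LinIndep B J → count J ≤ ρ
  rank-bound J J⊆X J-indep =
    subst (_≤ ρ) (trans (count-card (tabulate J)) (count-cong _ _ (lookup∘tabulate J)))
      (proj₂ R (tabulate J) (⊆ᵇ⇒⊆ (λ j → J⊆X j ∘ trans (sym (lookup∘tabulate J j))))
               (linIndep⇒independent (linIndep-⊆ J-indep (λ j → trans (sym (lookup∘tabulate J j))))))

  basis : Bits m
  basis = lookup (proj₁ (proj₁ R))

  basis⊆ : basis ⊆ᵇ lookup X
  basis⊆ = ⊆⇒⊆ᵇ (proj₁ (proj₂ (proj₁ R)))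

  basis-linIndep : LinIndep B basis
  basis-linIndep = independent⇒linIndep (proj₁ (proj₂ (proj₂ (proj₁ R))))

  basis-count : count basis ≡ ρ
  basis-count = trans (sym (count-card (proj₁ (proj₁ R)))) (proj₂ (proj₂ (proj₂ (proj₁ R))))

  -- A largest independent subset J of X spans X: every column of X is a sum
  -- of columns of J (otherwise J ∪ {e} would be a larger independent set).
  spans : (J : Bits m) → J ⊆ᵇ lookup X → LinIndep B J → ρ ≤ count J →
          ∀ e → lookup X e ≡ true → ∃ λ S → S ⊆ᵇ J × (∀ i → S · B i ≡ B i e)
  spans J J⊆X J-indep ρ≤|J| e Xe with J e in Je
  ... | true = ⁅ e ⁆ᵇ , (λ x x≡e → trans (cong J (⁅⁆-sound x≡e)) Je) , (λ i → ·-singletonˡ e (B i))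
  ... | false with dependent? B (insert J e)
  ...   | no J+e-indep =
    ⊥-elim (<⇒≱ (subst (_≤ ρ) (count-insert J e Je) (rank-bound (insert J e) (insert⊆ J⊆X Xe) J+e-indep)) ρ≤|J|)
  ...   | yes (S , S⊆J+e , nonEmpty , sums) with S e in Se
  ...     | false = ⊥-elim (J-indep (S , ⊆insert-avoiding S⊆J+e Se , nonEmpty , sums))
  ...     | true  = (λ x → ⁅ e ⁆ᵇ x xor S x) , ⊆insert-toggle S⊆J+e Se ,
                    λ i → trans (·-xorˡ ⁅ e ⁆ᵇ S (B i))
                                (trans (cong₂ _xor_ (·-singletonˡ e (B i)) (sums i)) (xor-identityʳ (B i e)))

  cocycle-vanishes-on-span : (y : Bits r) → (∀ j → basis j ≡ true → cocycle B y j ≡ false) →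
                             ∀ e → lookup X e ≡ true → cocycle B y e ≡ false
  cocycle-vanishes-on-span y vanishes e Xe
    with spans basis basis⊆ basis-linIndep (≤-reflexive (sym basis-count)) e Xe
  ... | S , S⊆basis , e=ΣS =
    trans (cocycle-on-sum B y S e=ΣS)
          (trans (·-agree S _ (λ _ → false) (λ j → vanishes j ∘ S⊆basis j)) (·-zeroʳ S _ (λ _ → refl)))

-- Cocycles: supports of linear functionals on the columns

-- If y vanishes on an independent set I but not on column q, then I ∪ {q} is
-- independent: y would send a dependency through q to 1 and to 0.
linIndep-insert : (B : Matrix r m) (y : Bits r) (I : Bits m) (q : Fin m) →
                  (∀ j → I j ≡ true → cocycle B y j ≡ false) → cocycle B y q ≡ true →
                  LinIndep B I → LinIndep B (insert I q)
linIndep-insert B y I q vanishes yq indep (S , S⊆I+q , nonEmpty , sums) with S q in Sq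
... | false = indep (S , ⊆insert-avoiding S⊆I+q Sq , nonEmpty , sums)
... | true  = false≢true (begin
  false                  ≡⟨ sym (·-zeroʳ y _ sums) ⟩
  y · (λ i → S · B i)    ≡⟨ ·-exchange y S B ⟩
  S · cocycle B y        ≡⟨ ·-agree S _ _ onS ⟩
  S · ⁅ q ⁆ᵇ             ≡⟨ ·-singletonʳ q S ⟩
  S q                    ≡⟨ Sq ⟩
  true                   ∎)
  where
  open ≡-Reasoning
  onS : ∀ j → S j ≡ true → cocycle B y j ≡ ⁅ q ⁆ᵇ j
  onS j Sj = case j ≟ q of λ where
    (yes refl) → trans yq (sym (⁅⁆-here j))
    (no j≢q)   → trans (vanishes j (trans (sym (insert-elsewhere I j≢q)) (S⊆I+q j Sj))) (sym (⁅⁆-elsewhere j≢q))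

module _ {B : Matrix r m} {ρE : ℕ} (RE : IsRank B ⊤ ρE) where

  -- The complement of a nonempty cocycle is not spanning: a basis of it
  -- extends, by any element of the cocycle, to a larger independent set.
  cocycle-coSpansFails : (y : Bits r) → NonEmpty (cocycle B y) → CoSpansFails B (tabulate (cocycle B y))
  cocycle-coSpansFails y (e , ye) = ρ , ρE , R , RE , subst (_≤ ρE) size (rank-bound RE _ (λ x _ → lookup-⊤ x) indep)
    where
    C : Subset m
    C = tabulate (cocycle B y)
    ρ : ℕ
    ρ = proj₁ (rank B (∁ C))
    R : IsRank B (∁ C) ρ
    R = proj₂ (rank B (∁ C))
    outside : ∀ x → lookup (∁ C) x ≡ true → cocycle B y x ≡ false
    outside x x∉C with cocycle B y x in yx
    ... | false = refl
    ... | true  = ⊥-elim (false≢true (trans (sym (cong not (trans (lookup∘tabulate _ x) yx)))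
                                             (trans (sym (lookup-∁ C x)) x∉C)))
    e∉basis : basis R e ≡ false
    e∉basis with basis R e in be
    ... | false = refl
    ... | true  = ⊥-elim (true≢false (trans (sym ye) (outside e (basis⊆ R e be))))
    indep : LinIndep B (insert (basis R) e)
    indep = linIndep-insert B y (basis R) e (λ x → outside x ∘ basis⊆ R x) ye (basis-linIndep R)
    size : count (insert (basis R) e) ≡ suc ρ
    size = trans (count-insert (basis R) e e∉basis) (cong suc (basis-count R))

  coSpansFails? : (Q : Subset m) → Dec (CoSpansFails B Q)
  coSpansFails? Q with proj₁ (rank B (∁ Q)) <? ρE
  ... | yes < = yes (_ , ρE , proj₂ (rank B (∁ Q)) , RE , <)
  ... | no ≮ = no λ (a , b , Ra , Rb , a<b) →
                 ≮ (subst₂ _<_ (rank-unique Ra (proj₂ (rank B (∁ Q)))) (rank-unique Rb RE) a<b)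

  -- A nonempty cocycle contains a cocircuit: a smallest subset with
  -- non-spanning complement.
  cocircuit-in-cocycle : (y : Bits r) → NonEmpty (cocycle B y) →
                         ∃ λ Q → IsCocircuit B Q × Q ⊆ tabulate (cocycle B y)
  cocircuit-in-cocycle y nonEmpty
    with smallest (λ S → S ⊆ tabulate (cocycle B y) × CoSpansFails B S)
                  (λ S → (S ⊆? tabulate (cocycle B y)) ×-dec coSpansFails? S)
  ... | inj₁ none = ⊥-elim (none (tabulate (cocycle B y)) ((λ x∈ → x∈) , cocycle-coSpansFails y nonEmpty))
  ... | inj₂ (Q , (Q⊆C , fails) , minimal) =
        Q , (fails , λ Q′ Q′⊆Q fails′ → ⊆-size-equal Q′ Q Q′⊆Q (minimal Q′ ((Q⊆C ∘ Q′⊆Q) , fails′))) ,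
        Q⊆C

-- Matrices containing the identity matrix among their columns (at positions u),
-- such as the standard representations [I | D].
module UnitColumns {B : Matrix r m} (u : Fin r → Fin m) (unit : ∀ y p → cocycle B y (u p) ≡ y p) where

  nonEmpty-cocycle : (y : Bits r) → NonEmpty y → NonEmpty (cocycle B y)
  nonEmpty-cocycle y (p , yp) = u p , trans (unit y p) yp

  -- Such a matrix has full row rank: otherwise a nonzero functional would
  -- vanish on a basis, hence on all columns, including the unit ones.
  full-rank : IsRank B ⊤ r
  full-rank with rank B ⊤
  ... | ρ , R = subst (IsRank B ⊤) (≤-antisym ρ≤r r≤ρ) R
    where
    ρ≤r : ρ ≤ r
    ρ≤r = subst₂ _≤_ (basis-count R) (count-all r)
            (linIndep≤support B (basis R) (λ _ → true) (λ _ ()) (basis-linIndep R))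
    r≤ρ : r ≤ ρ
    r≤ρ with r ≤? ρ
    ... | yes r≤ρ = r≤ρ
    ... | no r≰ρ with annihilator B (basis R) (subst (_< r) (sym (basis-count R)) (≰⇒> r≰ρ))
    ...   | y , (p , yp) , vanishes =
            ⊥-elim (true≢false (trans (sym yp) (trans (sym (unit y p))
              (cocycle-vanishes-on-span R y vanishes (u p) (lookup-⊤ (u p))))))

  -- Every cocircuit Q is a cocycle: its complement has rank < r, so a nonzero
  -- functional vanishes on it; its cocycle lies in Q, and is Q by minimality.
  cocircuit-is-cocycle : (Q : Subset m) → IsCocircuit B Q →
                         ∃ λ y → NonEmpty (cocycle B y) × (∀ e → cocycle B y e ≡ lookup Q e)
  cocircuit-is-cocycle Q ((ρ , ρE , R , RE , ρ<ρE) , minimal)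
    with annihilator B (basis R) (subst (_< r) (sym (basis-count R)) (subst (ρ <_) (rank-unique RE full-rank) ρ<ρE))
  ... | y , nonZero , vanishes = y , nonEmpty , λ e → trans (sym (lookup∘tabulate _ e)) (cong (λ Z → lookup Z e) C≡Q)
    where
    nonEmpty : NonEmpty (cocycle B y)
    nonEmpty = nonEmpty-cocycle y nonZero
    C⊆Q : tabulate (cocycle B y) ⊆ Q
    C⊆Q {e} e∈C with lookup Q e in Qe
    ... | true  = true⇒∈ Qe
    ... | false = ⊥-elim (true≢false (trans (sym (trans (sym (lookup∘tabulate _ e)) (∈⇒true e∈C)))
                    (cocycle-vanishes-on-span R y vanishes e (trans (lookup-∁ Q e) (cong not Qe)))))
    C≡Q : tabulate (cocycle B y) ≡ Q
    C≡Q = minimal _ C⊆Q (cocycle-coSpansFails full-rank y nonEmpty)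

CocircuitBound : Matrix r m → Subset m → Set
CocircuitBound B T = ∀ Q → IsCocircuit B Q → Nonempty (Q ∩ T) → 2 * ∣ Q ∩ T ∣ ≤ ∣ Q ∣

module CocycleBound {B : Matrix r m} (u : Fin r → Fin m) (unit : ∀ y p → cocycle B y (u p) ≡ y p)
                    (T : Subset m) (hyp : CocircuitBound B T) where
  open UnitColumns {B = B} u unit

  meetT : Bits m → ℕ
  meetT C = count (λ e → C e ∧ lookup T e)

  cocircuit-bound : (Q : Subset m) → IsCocircuit B Q → 2 * meetT (lookup Q) ≤ count (lookup Q)
  cocircuit-bound Q cocircuit with nonempty? (Q ∩ T)
  ... | yes meets = subst₂ (λ a b → 2 * a ≤ b) |Q∩T| (count-card Q) (hyp Q cocircuit meets)
    where
    |Q∩T| : ∣ Q ∩ T ∣ ≡ meetT (lookup Q)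
    |Q∩T| = trans (count-card (Q ∩ T)) (count-cong _ _ (λ e → lookup-zipWith _∧_ e Q T))
  ... | no disjoint = subst (λ a → 2 * a ≤ count (lookup Q)) (sym (count-empty _ outside)) z≤n
    where
    outside : ∀ e → lookup Q e ∧ lookup T e ≡ false
    outside e with lookup Q e ∧ lookup T e in QTe
    ... | false = refl
    ... | true  = ⊥-elim (disjoint (e , true⇒∈ (trans (lookup-zipWith _∧_ e Q T) QTe)))

  meetT-cong : {C C′ : Bits m} → (∀ e → C e ≡ C′ e) → meetT C ≡ meetT C′
  meetT-cong C≗C′ = count-cong _ _ (λ e → cong (_∧ lookup T e) (C≗C′ e))

  cocycle-split : (y y′ : Bits r) → cocycle B y′ ⊆ᵇ cocycle B y →
    count (cocycle B y) ≡ count (cocycle B y′) + count (cocycle B (λ i → y i xor y′ i)) ×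
    meetT (cocycle B y) ≡ meetT (cocycle B y′) + meetT (cocycle B (λ i → y i xor y′ i))
  cocycle-split y y′ Q′⊆C =
    trans (count-split _ _ Q′⊆C) (cong (count Q′ +_) (count-cong _ _ (sym ∘ cocycle-xor B y y′))) ,
    trans (count-split _ _ (λ e → ∧-mono (Q′⊆C e))) (cong (meetT Q′ +_) (count-cong _ _ rest∧T))
    where
    C Q′ : Bits m
    C  = cocycle B y
    Q′ = cocycle B y′
    ∧-mono : ∀ {a a′ t} → (a′ ≡ true → a ≡ true) → a′ ∧ t ≡ true → a ∧ t ≡ true
    ∧-mono {a′ = true} a′⇒a a′∧t rewrite a′⇒a refl = a′∧t
    rest∧T : ∀ e → (C e ∧ lookup T e) xor (Q′ e ∧ lookup T e) ≡ cocycle B (λ i → y i xor y′ i) e ∧ lookup T e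
    rest∧T e = trans (sym (∧-distribʳ-xor (lookup T e) (C e) (Q′ e))) (cong (_∧ lookup T e) (sym (cocycle-xor B y y′ e)))

  -- The bound extends from cocircuits to all cocycles: a nonempty cocycle C
  -- contains a cocircuit Q, which is itself a cocycle; C splits into Q and
  -- the smaller cocycle C + Q, and the bound adds up (induction on |C|).
  cocycle-bound : (y : Bits r) → 2 * meetT (cocycle B y) ≤ count (cocycle B y)
  cocycle-bound y = <-rec Bound step (count (cocycle B y)) y refl
    where
    Bound : ℕ → Set
    Bound N = ∀ y → count (cocycle B y) ≡ N → 2 * meetT (cocycle B y) ≤ count (cocycle B y)
    step : ∀ N → (∀ {N′} → N′ < N → Bound N′) → Bound N
    step N smaller y size with nonEmpty? (cocycle B y)
    ... | no empty =
      subst (λ a → 2 * a ≤ _) (sym (count-empty _ (λ e → cong (_∧ lookup T e) (¬nonEmpty⇒false _ empty e)))) z≤n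
    ... | yes nonEmpty =
      let (Q , cocircuit , Q⊆C)   = cocircuit-in-cocycle full-rank y nonEmpty
          (y′ , Q-nonEmpty , y′≗Q) = cocircuit-is-cocycle Q cocircuit
          Q′⊆C : cocycle B y′ ⊆ᵇ cocycle B y
          Q′⊆C e Q′e = trans (sym (lookup∘tabulate _ e)) (∈⇒true (Q⊆C (true⇒∈ (trans (sym (y′≗Q e)) Q′e))))
          y″ : Bits r
          y″ i = y i xor y′ i
          (count-eq , meet-eq) = cocycle-split y y′ Q′⊆C
          Q′-bound : 2 * meetT (cocycle B y′) ≤ count (cocycle B y′)
          Q′-bound = subst₂ (λ a b → 2 * a ≤ b) (meetT-cong (sym ∘ y′≗Q)) (count-cong _ _ (sym ∘ y′≗Q))
                       (cocircuit-bound Q cocircuit)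
          rest-smaller : count (cocycle B y″) < N
          rest-smaller = subst (count (cocycle B y″) <_) (trans (sym count-eq) size)
                           (m<n+m _ (count-nonEmpty _ Q-nonEmpty))
          rest-bound : 2 * meetT (cocycle B y″) ≤ count (cocycle B y″)
          rest-bound = smaller rest-smaller y″ refl
      in subst₂ (λ a b → 2 * a ≤ b) (sym meet-eq) (sym count-eq)
           (subst (_≤ count (cocycle B y′) + count (cocycle B y″))
                  (sym (*-distribˡ-+ 2 (meetT (cocycle B y′)) (meetT (cocycle B y″))))
                  (+-mono-≤ Q′-bound rest-bound))

-- Element splitting

-- A with the row t added on top: the matrix of M′_T without the column a.
withRow : Bits m → Matrix r m → Matrix (suc r) m
withRow t A zero    = t
withRow t A (suc i) = A i

module Splitting (A : Matrix r m) (T : Subset m) where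

  A′ : Matrix (suc r) (suc m)
  A′ = splitMatrix A T

  Aₜ : Matrix (suc r) m
  Aₜ = withRow (lookup T) A

  independent-without-a : {J : Subset m} → LinIndep Aₜ (lookup J) → Independent A′ (false ∷ J)
  independent-without-a indep (true ∷ S) S⊆J _ _ with ⊆⇒⊆ᵇ S⊆J zero refl
  ... | ()
  independent-without-a indep (false ∷ S) S⊆J (suc j , j∈S) sums =
    indep (lookup S , ⊆⇒⊆ᵇ (drop-∷-⊆ S⊆J) , (j , ∈⇒true (drop-there j∈S)) ,
           λ { zero → sums zero ; (suc i) → sums (suc i) })

  -- Adding a to an A-independent set keeps it independent in A′, since the
  -- column of a is the only one with a 1 in row 0 and zeros below.
  independent-with-a : {J : Subset m} → LinIndep A (lookup J) → Independent A′ (true ∷ J)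
  independent-with-a indep (false ∷ S) S⊆J (suc j , j∈S) sums =
    indep (lookup S , ⊆⇒⊆ᵇ (drop-∷-⊆ S⊆J) , (j , ∈⇒true (drop-there j∈S)) , sums ∘ suc)
  independent-with-a indep (true ∷ S) S⊆J _ sums with nonEmpty? (lookup S)
  ... | yes nonEmpty = indep (lookup S , ⊆⇒⊆ᵇ (drop-∷-⊆ S⊆J) , nonEmpty , sums ∘ suc)
  ... | no empty = true≢false (trans (cong not (sym (·-zeroˡ (lookup S) (lookup T) (¬nonEmpty⇒false _ empty)))) (sums zero))

  split-rank≤ : {ρ : ℕ} → IsRank A′ ⊤ ρ → ρ ≤ suc r
  split-rank≤ R = subst₂ _≤_ (basis-count {B = A′} R) (count-all (suc r))
                    (linIndep≤support A′ (basis {B = A′} R) (λ _ → true) (λ _ ()) (basis-linIndep {B = A′} R))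

  rank-without-a : {X : Subset m} {ρ′ : ℕ} → IsRank A′ (false ∷ X) ρ′ →
                   (J : Bits m) → J ⊆ᵇ lookup X → LinIndep Aₜ J → count J ≤ ρ′
  rank-without-a {X} R′ J J⊆X indep =
    subst (_≤ _) (trans (count-card (tabulate J)) (count-cong _ _ (lookup∘tabulate J)))
      (proj₂ R′ (false ∷ tabulate J) (⊆ᵇ⇒⊆ J′⊆X′)
         (independent-without-a (linIndep-⊆ indep (λ j → trans (sym (lookup∘tabulate J j))))))
    where
    J′⊆X′ : lookup (false ∷ tabulate J) ⊆ᵇ lookup (false ∷ X)
    J′⊆X′ (suc j) Jj = J⊆X j (trans (sym (lookup∘tabulate J j)) Jj)

  rank-with-a : {Y : Subset m} {ρ ρ′ : ℕ} → IsRank A Y ρ → IsRank A′ (true ∷ Y) ρ′ → suc ρ ≤ ρ′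
  rank-with-a {Y} ((I , I⊆Y , I-indep , refl) , _) R′ =
    proj₂ R′ (true ∷ I) (⊆ᵇ⇒⊆ I′⊆Y′) (independent-with-a (independent⇒linIndep I-indep))
    where
    I′⊆Y′ : lookup (true ∷ I) ⊆ᵇ lookup (true ∷ Y)
    I′⊆Y′ zero    _  = refl
    I′⊆Y′ (suc j) Ij = ⊆⇒⊆ᵇ I⊆Y j Ij

  -- Adding the row T either raises the rank of X, or T restricted to X is
  -- already the value of a functional on the rows of A: then an A-basis of X
  -- is an Aₜ-basis, it spans X in Aₜ, and interpolating T on it gives y.
  rank-rises-or-T-is-cocycle : {X : Subset m} {ρ : ℕ} → IsRank A X ρ →
    (∃ λ J → J ⊆ᵇ lookup X × LinIndep Aₜ J × suc ρ ≤ count J) ⊎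
    (∃ λ y → ∀ e → lookup X e ≡ true → cocycle A y e ≡ lookup T e)
  rank-rises-or-T-is-cocycle {X} {ρ} R with rank Aₜ X
  ... | ρ′ , R′ with suc ρ ≤? ρ′
  ...   | yes rises =
    inj₁ (basis R′ , basis⊆ R′ , basis-linIndep R′ , subst (suc ρ ≤_) (sym (basis-count R′)) rises)
  ...   | no ¬rises with interpolate A (basis R) (lookup T) (basis-linIndep R)
  ...     | y , interpolates = inj₂ (y , agrees)
    where
    indep : LinIndep Aₜ (basis R)
    indep = linIndep-addRow (basis-linIndep R)
    ρ′≤|basis| : ρ′ ≤ count (basis R)
    ρ′≤|basis| = subst (ρ′ ≤_) (sym (basis-count R)) (≤-pred (≰⇒> ¬rises))
    agrees : ∀ e → lookup X e ≡ true → cocycle A y e ≡ lookup T e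
    agrees e Xe with spans R′ (basis R) (basis⊆ R) indep ρ′≤|basis| e Xe
    ... | S , S⊆basis , e=ΣS = begin
      cocycle A y e      ≡⟨ cocycle-on-sum A y S (e=ΣS ∘ suc) ⟩
      S · cocycle A y    ≡⟨ ·-agree S _ _ (λ j → interpolates j ∘ S⊆basis j) ⟩
      S · lookup T       ≡⟨ e=ΣS zero ⟩
      lookup T e         ∎
      where open ≡-Reasoning

-- Separations

separation-swap : {B : Matrix r m} {c : ℕ} {X : Subset m} → IsKSeparation B c X → IsKSeparation B c (∁ X)
separation-swap {B = B} {c} {X} (c≤|X| , c≤|Y| , ρX , ρY , ρE , RX , RY , RE , ineq) =
  c≤|Y| , subst (λ Z → c ≤ ∣ Z ∣) (sym (∁-involutive X)) c≤|X| ,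
  ρY , ρX , ρE , RY , subst (λ Z → IsRank B Z ρX) (sym (∁-involutive X)) RX , RE , subst (_< ρE + c) (+-comm ρX ρY) ineq

-- The rank inequality of a separation of M′_T, transported to ranks a ≤ r′(X′),
-- b < r′(Y′) of M, using r′(E′) ≤ r + 1.
separation-inequality : ∀ {a b rX′ rY′ rE′ r c} → a ≤ rX′ → suc b ≤ rY′ → rE′ ≤ suc r →
                        rX′ + rY′ < rE′ + c → a + b < r + c
separation-inequality {a} {b} {rX′} {rY′} {rE′} {r} {c} a≤rX′ b<rY′ rE′≤1+r ineq = ≤-pred (begin
  suc (suc (a + b))  ≡⟨ cong suc (sym (+-suc a b)) ⟩
  suc (a + suc b)    ≤⟨ s≤s (+-mono-≤ a≤rX′ b<rY′) ⟩
  suc (rX′ + rY′)    ≤⟨ ineq ⟩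
  rE′ + c            ≤⟨ +-monoˡ-≤ c rE′≤1+r ⟩
  suc r + c          ∎)
  where open ≤-Reasoning

∁-empty⇒⊤ : (X : Subset m) → ∣ ∁ X ∣ ≡ 0 → X ≡ ⊤
∁-empty⇒⊤ {m} X |∁X|≡0 =
  ∣p∣≡n⇒p≡⊤ (≤-antisym (∣p∣≤n X) (m∸n≡0⇒m≤n (trans (sym (∣∁p∣≡n∸∣p∣ X)) |∁X|≡0)))

standard-unit : {k : ℕ} (D : Matrix r k) (y : Bits r) (p : Fin r) → cocycle (standard D) y (p ↑ˡ k) ≡ y p
standard-unit {r} {k} D y p =
  trans (·-cong (λ _ → refl) (λ i → cong [ (λ c → ⌊ i ≟ c ⌋) , D i ] (splitAt-↑ˡ r p k))) (·-singletonʳ p y)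

module Proposition {n r k : ℕ} (D : Matrix r k) (T : Subset (r + k))
  (connected : NConnected n (standard D)) (|T|≡n-1 : ∣ T ∣ ≡ n ∸ 1) (hyp : CocircuitBound (standard D) T) where

  A : Matrix r (r + k)
  A = standard D

  open Splitting A T
  open UnitColumns {B = A} (_↑ˡ k) (standard-unit D) using (full-rank)
  open CocycleBound {B = A} (_↑ˡ k) (standard-unit D) T hyp using (cocycle-bound)

  no-separation : ∀ c → 1 ≤ c → c < n → (X : Subset (r + k)) {ρX ρY : ℕ} →
                  IsRank A X ρX → IsRank A (∁ X) ρY → c ≤ ∣ X ∣ → c ≤ ∣ ∁ X ∣ → ¬ (ρX + ρY < r + c)
  no-separation c 1≤c c<n X RX RY c≤|X| c≤|Y| ineq =
    connected c 1≤c c<n X (c≤|X| , c≤|Y| , _ , _ , r , RX , RY , full-rank , ineq)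

  no-tight-separation : (X : Subset (r + k)) {ρX ρY : ℕ} → IsRank A X ρX → IsRank A (∁ X) ρY →
                        ∣ ∁ X ∣ < ∣ X ∣ → ∣ ∁ X ∣ < n → ¬ (ρX + ρY < r + ∣ ∁ X ∣)
  no-tight-separation X {ρX} {ρY} RX RY |Y|<|X| |Y|<n ineq with ∣ ∁ X ∣ in |Y|
  ... | suc c = no-separation (suc c) (s≤s z≤n) |Y|<n X RX RY (<⇒≤ |Y|<|X|) (≤-reflexive (sym |Y|)) ineq
  ... | zero  = <⇒≱ ineq (≤-trans (≤-reflexive (+-identityʳ r)) (subst (λ ρ → r ≤ ρ + ρY) ρX≡r (m≤m+n r ρY)))
    where
    ρX≡r : r ≡ ρX
    ρX≡r = rank-unique full-rank (subst (λ Z → IsRank A Z ρX) (∁-empty⇒⊤ X |Y|) RX)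

  T-outside-X : (X : Subset (r + k)) (y : Bits r) → (∀ e → lookup X e ≡ true → cocycle A y e ≡ lookup T e) →
                ∣ T ∣ ≤ ∣ ∁ X ∣
  T-outside-X X y agrees =
    subst₂ _≤_ (sym (count-card T)) (trans (count-cong _ _ (sym ∘ lookup-∁ X)) (sym (count-card (∁ X))))
      (+-cancelˡ-≤ (count C) _ _ (begin
        count C + count (lookup T)                            ≡⟨ +-comm (count C) _ ⟩
        count (lookup T) + count C                            ≤⟨ agreement-count C (lookup T) (lookup X) agrees ⟩
        2 * count (λ e → C e ∧ lookup T e) + count (not ∘ lookup X) ≤⟨ +-monoˡ-≤ _ (cocycle-bound y) ⟩
        count C + count (not ∘ lookup X)                      ∎))
    where
    open ≤-Reasoning
    C : Bits (r + k)
    C = cocycle A y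

  -- With X = X′ and
  -- Y = E − X: r′(X′) ≥ r(X), r′(Y′) > r(Y) and r′(E′) ≤ r + 1, so (X, Y) would be
  -- a j-separation of M unless |Y| = j − 1.  In that case either adding the row T
  -- raises the rank of X, and (X, Y) is a (j − 1)-separation of M, or T agrees
  -- on X with a cocycle, and then |T| ≤ |Y| = j − 1 < n − 1.
  no-split-separation : ∀ j → 1 ≤ j → j < n → (X : Subset (r + k)) → ¬ IsKSeparation A′ j (false ∷ X)
  no-split-separation j 1≤j j<n X (j≤|X| , j≤1+|Y| , _ , _ , _ , RX′ , RY′ , RE′ , ineq′) =
    by-cases (rank A X) (rank A (∁ X))
    where
    by-cases : Σ ℕ (IsRank A X) → Σ ℕ (IsRank A (∁ X)) → ⊥
    by-cases (ρX , RX) (ρY , RY) with j ≤? ∣ ∁ X ∣ | rank-rises-or-T-is-cocycle RX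
    ... | yes j≤|Y| | _ =
      no-separation j 1≤j j<n X RX RY j≤|X| j≤|Y| (in-M (rank-without-a RX′ _ (basis⊆ RX) basis-indep))
      where
      basis-indep : LinIndep Aₜ (basis RX)
      basis-indep = linIndep-addRow (basis-linIndep RX)
      in-M : count (basis RX) ≤ _ → ρX + ρY < r + j
      in-M |basis|≤rX′ = separation-inequality (subst (_≤ _) (basis-count RX) |basis|≤rX′)
                           (rank-with-a RY RY′) (split-rank≤ RE′) ineq′
    ... | no j≰|Y| | inj₁ (J , J⊆X , indep , rises) =
      no-tight-separation X RX RY (≤-trans |Y|<j j≤|X|) (<-trans |Y|<j j<n) (≤-pred (begin
        suc (suc (ρX + ρY))  ≤⟨ separation-inequality (≤-trans rises (rank-without-a RX′ J J⊆X indep))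
                                                      (rank-with-a RY RY′) (split-rank≤ RE′) ineq′ ⟩
        r + j                ≤⟨ +-monoʳ-≤ r j≤1+|Y| ⟩
        r + suc ∣ ∁ X ∣      ≡⟨ +-suc r _ ⟩
        suc (r + ∣ ∁ X ∣)    ∎))
      where
      open ≤-Reasoning
      |Y|<j : ∣ ∁ X ∣ < j
      |Y|<j = ≰⇒> j≰|Y|
    ... | no j≰|Y| | inj₂ (y , agrees) = <⇒≱ (<-≤-trans (s≤s (≰⇒> j≰|Y|)) j<n) (begin
      n                  ≤⟨ m≤n+m∸n n 1 ⟩
      suc (n ∸ 1)        ≡⟨ cong suc (sym |T|≡n-1) ⟩
      suc ∣ T ∣          ≤⟨ s≤s (T-outside-X X y agrees) ⟩
      suc ∣ ∁ X ∣        ∎)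
      where open ≤-Reasoning

-- M′_T is n-connected: a separation with a on its first side is swapped.
proposition3p3 :
    (n : ℕ) → 2 ≤ n →
    (r k : ℕ) → (D : Matrix r k) →
    NConnected n (standard D) →
    2 * n ∸ 2 ≤ r + k →
    (T : Subset (r + k)) → ∣ T ∣ ≡ n ∸ 1 →
    (∀ Q → IsCocircuit (standard D) Q → Nonempty (Q ∩ T) →
       2 * ∣ Q ∩ T ∣ ≤ ∣ Q ∣) →
    NConnected n (splitMatrix (standard D) T)
proposition3p3 n _ r k D connected _ T |T| hyp j 1≤j j<n (false ∷ X) separation =
  Proposition.no-split-separation D T connected |T| hyp j 1≤j j<n X separation
proposition3p3 n _ r k D connected _ T |T| hyp j 1≤j j<n (true ∷ X) separation =
  Proposition.no-split-separation D T connected |T| hyp j 1≤j j<n (∁ X)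
    (separation-swap {B = splitMatrix (standard D) T} separation)
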